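{- For every program $P$, the poset $(\mathrm{Pos}(P),\leq)$ of positions of $P$ is a lattice which is a well-order and is finitely complemented.
   Context: Fix a set $\mathcal A$ of actions. Programs: $P,Q::=A\mid P;Q\mid P^{*}\mid P+Q\mid P\parallel Q$ with $A\in\mathcal A$. Pre-positions: $p,q::=\bot\mid\top\mid p;q\mid p^{(n)}\mid p+q\mid p\parallel q$ with $n\in\mathbb N$. Validity $P\vdash p$: $P\vdash\bot$, $P\vdash\top$ for all $P$; if $P\vdash p$ then $P;Q\vdash p;\bot$, $P+Q\vdash p+\bot$, $P^*\vdash p^{(n)}$ for all $n$; if $Q\vdash q$ then $P;Q\vdash\top;q$, $P+Q\vdash\bot+q$; if $P\vdash p$ and $Q\vdash q$ then $P\parallel Q\vdash p\parallel q$. $\mathrm{Pos}(P)=\{p:P\vdash p\}$. The order $\leq$ on $\mathrm{Pos}(P)$ is the smallest reflexive relation with: $\bot\leq p$; $p\leq\top$; if $p\leq p'$, $q\leq q'$ then $p;q\leq p';q'$, $p+q\leq p'+q'$, $p\parallel q\leq p'\parallel q'$; if $p\leq p'$ then $p^{(n)}\leq p'^{(n)}$; $p^{(m)}\leq p'^{(n)}$ for $m<n$. A well-order is a poset in which every infinite sequence $(x_i)$ has $i<j$ with $x_i\leq x_j$. In a poset $X$, for $Y\subseteq X$: $\downarrow Y=\{x:\exists y\in Y,x\leq y\}$, $\uparrow Y$ dually; $Y^{\downarrow c}=\{x:\forall y\in Y,x\not\geq y\}$, $Y^{\uparrow c}=\{x:\forall y\in Y,x\not\leq y\}$; $Y$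 is finitely lower (upper) generated if $Y=\downarrow Y'$ ($\uparrow Y'$) for a finite $Y'$; $x\in X$ is finitely lower complemented if $\{x\}^{\downarrow c}$ is finitely lower generated and finitely upper complemented if $\{x\}^{\uparrow c}$ is finitely upper generated; $\max$, $\min$ denote sets of maximal/minimal elements. $X$ is finitely complemented if (i) for every finitely lower complemented $x$, every element of $\max(\{x\}^{\downarrow c})$ is finitely upper complemented, and (ii) for every finitely upper complemented $x$, every element of $\min(\{x\}^{\uparrow c})$ is finitely lower complemented. -}

module Defs where

open import Data.Nat using (ℕ; _<_)
open import Data.Product using (Σ; ∃; _×_; proj₁; _,_)
open import Data.List using (List)
open import Data.List.Relation.Unary.Any using (Any)
open import Relation.Nullary using (¬_)
open import Relation.Binary.PropositionalEquality using (_≡_)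
open import Relation.Binary.Lattice.Structures using (IsLattice)
open import Function.Bundles using (_⇔_)

infixr 6 _⨾_ _⨾ᵖ_
infixr 5 _⊕_ _⊕ᵖ_
infixr 4 _∥_ _∥ᵖ_
infix 3 _⊢_ _≤ᵖ_

data Prog (Act : Set) : Set where
  act : Act → Prog Act
  _⨾_ : Prog Act → Prog Act → Prog Act
  _⋆  : Prog Act → Prog Act
  _⊕_ : Prog Act → Prog Act → Prog Act
  _∥_ : Prog Act → Prog Act → Prog Act

data PrePos : Set where
  ⊥ᵖ ⊤ᵖ : PrePos
  _⨾ᵖ_ : PrePos → PrePos → PrePos
  _^ᵖ_ : PrePos → ℕ → PrePos
  _⊕ᵖ_ : PrePos → PrePos → PrePos
  _∥ᵖ_ : PrePos → PrePos → PrePos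

data _⊢_ {Act : Set} : Prog Act → PrePos → Set where
  ⊢⊥   : ∀ {P} → P ⊢ ⊥ᵖ
  ⊢⊤   : ∀ {P} → P ⊢ ⊤ᵖ
  ⊢seqˡ : ∀ {P Q p} → P ⊢ p → (P ⨾ Q) ⊢ (p ⨾ᵖ ⊥ᵖ)
  ⊢altˡ : ∀ {P Q p} → P ⊢ p → (P ⊕ Q) ⊢ (p ⊕ᵖ ⊥ᵖ)
  ⊢star : ∀ {P p} (n : ℕ) → P ⊢ p → (P ⋆) ⊢ (p ^ᵖ n)
  ⊢seqʳ : ∀ {P Q q} → Q ⊢ q → (P ⨾ Q) ⊢ (⊤ᵖ ⨾ᵖ q)
  ⊢altʳ : ∀ {P Q q} → Q ⊢ q → (P ⊕ Q) ⊢ (⊥ᵖ ⊕ᵖ q)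
  ⊢par  : ∀ {P Q p q} → P ⊢ p → Q ⊢ q → (P ∥ Q) ⊢ (p ∥ᵖ q)

data _≤ᵖ_ : PrePos → PrePos → Set where
  ≤-refl : ∀ {p} → p ≤ᵖ p
  ⊥≤    : ∀ {p} → ⊥ᵖ ≤ᵖ p
  ≤⊤    : ∀ {p} → p ≤ᵖ ⊤ᵖ
  ≤-seq : ∀ {p p' q q'} → p ≤ᵖ p' → q ≤ᵖ q' → (p ⨾ᵖ q) ≤ᵖ (p' ⨾ᵖ q')
  ≤-alt : ∀ {p p' q q'} → p ≤ᵖ p' → q ≤ᵖ q' → (p ⊕ᵖ q) ≤ᵖ (p' ⊕ᵖ q')
  ≤-par : ∀ {p p' q q'} → p ≤ᵖ p' → q ≤ᵖ q' → (p ∥ᵖ q) ≤ᵖ (p' ∥ᵖ q')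
  ≤-star : ∀ {p p' n} → p ≤ᵖ p' → (p ^ᵖ n) ≤ᵖ (p' ^ᵖ n)
  ≤-iter : ∀ {p p' m n} → m < n → (p ^ᵖ m) ≤ᵖ (p' ^ᵖ n)

-- Positions of P: valid pre-positions. Two positions are equal iff their
-- underlying pre-positions are equal (derivations of validity are irrelevant).
Pos : {Act : Set} → Prog Act → Set
Pos P = Σ PrePos (λ p → P ⊢ p)

module _ {Act : Set} (P : Prog Act) where
  _≈Pos_ : Pos P → Pos P → Set
  x ≈Pos y = proj₁ x ≡ proj₁ y

  _≤Pos_ : Pos P → Pos P → Set
  x ≤Pos y = proj₁ x ≤ᵖ proj₁ y

module OrderNotions {X : Set} (_≈_ : X → X → Set) (_≤_ : X → X → Set) where

  IsLatticeOrder : Set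
  IsLatticeOrder = Σ (X → X → X) λ _∨_ → Σ (X → X → X) λ _∧_ → IsLattice _≈_ _≤_ _∨_ _∧_

  -- well-order (in the paper's sense): every infinite sequence has i < j with x_i ≤ x_j
  IsWellOrder : Set
  IsWellOrder = (f : ℕ → X) → Σ ℕ λ i → Σ ℕ λ j → i < j × f i ≤ f j

  ↓_ : List X → X → Set
  (↓ L) x = Any (λ y → x ≤ y) L

  ↑_ : List X → X → Set
  (↑ L) x = Any (λ y → y ≤ x) L

  FinitelyLowerGenerated : (X → Set) → Set
  FinitelyLowerGenerated Y = Σ (List X) λ L → (x : X) → Y x ⇔ (↓ L) x

  FinitelyUpperGenerated : (X → Set) → Set
  FinitelyUpperGenerated Y = Σ (List X) λ L → (x : X) → Y x ⇔ (↑ L) x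

  singleDownComp : X → X → Set
  singleDownComp x z = ¬ (x ≤ z)

  singleUpComp : X → X → Set
  singleUpComp x z = ¬ (z ≤ x)

  FinitelyLowerComplemented : X → Set
  FinitelyLowerComplemented x = FinitelyLowerGenerated (singleDownComp x)

  FinitelyUpperComplemented : X → Set
  FinitelyUpperComplemented x = FinitelyUpperGenerated (singleUpComp x)

  IsMax : (X → Set) → X → Set
  IsMax Y y = Y y × ((z : X) → Y z → y ≤ z → z ≈ y)

  IsMin : (X → Set) → X → Set
  IsMin Y y = Y y × ((z : X) → Y z → z ≤ y → z ≈ y)

  FinitelyComplemented : Set
  FinitelyComplemented =
    ((x : X) → FinitelyLowerComplemented x →
       (y : X) → IsMax (singleDownComp x) y → FinitelyUpperComplemented y)
    × ((x : X) → FinitelyUpperComplemented x →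
       (y : X) → IsMin (singleUpComp x) y → FinitelyLowerComplemented y)

-- A position of a composite program is ⊥, ⊤
-- or the image of component positions under p ↦ p;⊥, q ↦ ⊤;q, p ↦ p+⊥, q ↦ ⊥+q, (p, q) ↦ p∥q
-- or p ↦ p^(n), and comparing two images reduces to comparing components (and exponents), so
-- joins and meets are computed componentwise. For the well-order, a position is coded by a
-- natural-number tag and component positions so that the pointwise order on codes implies the
-- order on positions; almost-full relations are closed under such pullbacks and under products
-- of decidable relations, which gives every sequence a good pair constructively. For finite
-- complementation, every y has a finite list generating {y}^{↑c} that moreover decides z ≤ y.
-- Dually, a minimal element y of {x}^{↑c} has a finite list generating {y}^{↓c}: the only
-- obstruction is the top of an iterated subprogram (below which lie all p^(n)), and it cannot
-- occur in such a y because some ⊥^(k) below it would be a smaller element of {x}^{↑c}.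
module Submission where

open import Data.Empty using (⊥-elim)
open import Data.List using (List; []; _∷_; _++_; map)
open import Data.List.Relation.Unary.All as All using (All; []; _∷_)
import Data.List.Relation.Unary.All.Properties as All
open import Data.List.Relation.Unary.Any as Any using (Any; here; there)
import Data.List.Relation.Unary.Any.Properties as Any
open import Data.Nat as ℕ using (ℕ; zero; suc; _<_; _≤_; z≤n; s≤s)
open import Data.Nat.Induction using (<-wellFounded)
import Data.Nat.Properties as ℕₚ
open import Data.Product using (Σ; _×_; _,_; proj₁; proj₂)
open import Data.Product.Relation.Binary.Pointwise.NonDependent using (Pointwise; ×-decidable)
open import Data.Sum as Sum using (_⊎_; inj₁; inj₂; [_,_]′)
open import Function using (flip; id; _∘_)
open import Function.Bundles using (mk⇔)
open import Induction.WellFounded using (Acc; acc)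
open import Level using (0ℓ)
open import Relation.Binary.Core using (Rel)
open import Relation.Binary.Definitions using (Transitive; Antisymmetric; Decidable; Tri; tri<; tri≈; tri>)
open import Relation.Binary.PropositionalEquality using (_≡_; refl; sym; trans; cong; cong₂)
open import Relation.Binary.Structures using (IsPartialOrder)
open import Relation.Nullary using (¬_; Dec; yes; no)
open import Relation.Nullary.Decidable using (_⊎-dec_)

open import Defs

private variable
  Act : Set
  P Q : Prog Act
  p q : PrePos
  m n : ℕ

≤ᵖ-trans : Transitive _≤ᵖ_
≤ᵖ-trans ≤-refl q≤r = q≤r
≤ᵖ-trans p≤q ≤-refl = p≤q
≤ᵖ-trans ⊥≤ _ = ⊥≤
≤ᵖ-trans _ ≤⊤ = ≤⊤
≤ᵖ-trans (≤-seq a b) (≤-seq c d) = ≤-seq (≤ᵖ-trans a c) (≤ᵖ-trans b d)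
≤ᵖ-trans (≤-alt a b) (≤-alt c d) = ≤-alt (≤ᵖ-trans a c) (≤ᵖ-trans b d)
≤ᵖ-trans (≤-par a b) (≤-par c d) = ≤-par (≤ᵖ-trans a c) (≤ᵖ-trans b d)
≤ᵖ-trans (≤-star a) (≤-star b) = ≤-star (≤ᵖ-trans a b)
≤ᵖ-trans (≤-star _) (≤-iter m<n) = ≤-iter m<n
≤ᵖ-trans (≤-iter m<n) (≤-star _) = ≤-iter m<n
≤ᵖ-trans (≤-iter l<m) (≤-iter m<n) = ≤-iter (ℕₚ.<-trans l<m m<n)

≤ᵖ-antisym : Antisymmetric _≡_ _≤ᵖ_
≤ᵖ-antisym ≤-refl _ = refl
≤ᵖ-antisym _ ≤-refl = refl
≤ᵖ-antisym ⊥≤ ⊥≤ = refl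
≤ᵖ-antisym ≤⊤ ≤⊤ = refl
≤ᵖ-antisym (≤-seq a b) (≤-seq c d) = cong₂ _⨾ᵖ_ (≤ᵖ-antisym a c) (≤ᵖ-antisym b d)
≤ᵖ-antisym (≤-alt a b) (≤-alt c d) = cong₂ _⊕ᵖ_ (≤ᵖ-antisym a c) (≤ᵖ-antisym b d)
≤ᵖ-antisym (≤-par a b) (≤-par c d) = cong₂ _∥ᵖ_ (≤ᵖ-antisym a c) (≤ᵖ-antisym b d)
≤ᵖ-antisym (≤-star a) (≤-star b) = cong (_^ᵖ _) (≤ᵖ-antisym a b)
≤ᵖ-antisym (≤-star _) (≤-iter n<n) = ⊥-elim (ℕₚ.<-irrefl refl n<n)
≤ᵖ-antisym (≤-iter n<n) (≤-star _) = ⊥-elim (ℕₚ.<-irrefl refl n<n)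
≤ᵖ-antisym (≤-iter m<n) (≤-iter n<m) = ⊥-elim (ℕₚ.<-asym m<n n<m)

≤⊥⇒≡⊥ : p ≤ᵖ ⊥ᵖ → p ≡ ⊥ᵖ
≤⊥⇒≡⊥ ≤-refl = refl
≤⊥⇒≡⊥ ⊥≤ = refl

⨾ᵖ-≤-inv : ∀ {p' q'} → (p ⨾ᵖ q) ≤ᵖ (p' ⨾ᵖ q') → p ≤ᵖ p' × q ≤ᵖ q'
⨾ᵖ-≤-inv ≤-refl = ≤-refl , ≤-refl
⨾ᵖ-≤-inv (≤-seq a b) = a , b

⊕ᵖ-≤-inv : ∀ {p' q'} → (p ⊕ᵖ q) ≤ᵖ (p' ⊕ᵖ q') → p ≤ᵖ p' × q ≤ᵖ q'
⊕ᵖ-≤-inv ≤-refl = ≤-refl , ≤-refl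
⊕ᵖ-≤-inv (≤-alt a b) = a , b

∥ᵖ-≤-inv : ∀ {p' q'} → (p ∥ᵖ q) ≤ᵖ (p' ∥ᵖ q') → p ≤ᵖ p' × q ≤ᵖ q'
∥ᵖ-≤-inv ≤-refl = ≤-refl , ≤-refl
∥ᵖ-≤-inv (≤-par a b) = a , b

^ᵖ-≤-inv : ∀ {p'} → (p ^ᵖ m) ≤ᵖ (p' ^ᵖ n) → m < n ⊎ (m ≡ n × p ≤ᵖ p')
^ᵖ-≤-inv ≤-refl = inj₂ (refl , ≤-refl)
^ᵖ-≤-inv (≤-star p≤p') = inj₂ (refl , p≤p')
^ᵖ-≤-inv (≤-iter m<n) = inj₁ m<n

^ᵖ-≤-exponent : ∀ {p'} → (p ^ᵖ m) ≤ᵖ (p' ^ᵖ n) → m ≤ n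
^ᵖ-≤-exponent ≤-refl = ℕₚ.≤-refl
^ᵖ-≤-exponent (≤-star _) = ℕₚ.≤-refl
^ᵖ-≤-exponent (≤-iter m<n) = ℕₚ.<⇒≤ m<n

^ᵖ-≤-base : ∀ {p'} → (p ^ᵖ n) ≤ᵖ (p' ^ᵖ n) → p ≤ᵖ p'
^ᵖ-≤-base ≤-refl = ≤-refl
^ᵖ-≤-base (≤-star p≤p') = p≤p'
^ᵖ-≤-base (≤-iter n<n) = ⊥-elim (ℕₚ.<-irrefl refl n<n)

^ᵖ-mono : ∀ {p'} → m ≤ n → p ≤ᵖ p' → (p ^ᵖ m) ≤ᵖ (p' ^ᵖ n)
^ᵖ-mono m≤n p≤p' with ℕₚ.m≤n⇒m<n∨m≡n m≤n
... | inj₁ m<n = ≤-iter m<n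
... | inj₂ refl = ≤-star p≤p'

_≟⊥ : (p : PrePos) → Dec (p ≡ ⊥ᵖ)
⊥ᵖ ≟⊥ = yes refl
⊤ᵖ ≟⊥ = no λ ()
(_ ⨾ᵖ _) ≟⊥ = no λ ()
(_ ^ᵖ _) ≟⊥ = no λ ()
(_ ⊕ᵖ _) ≟⊥ = no λ ()
(_ ∥ᵖ _) ≟⊥ = no λ ()

_≤ₚ_ : Pos P → Pos P → Set
x ≤ₚ y = proj₁ x ≤ᵖ proj₁ y

⊥ₚ ⊤ₚ : Pos P
⊥ₚ = ⊥ᵖ , ⊢⊥
⊤ₚ = ⊤ᵖ , ⊢⊤

seqˡ : Pos P → Pos (P ⨾ Q)
seqˡ (p , d) = p ⨾ᵖ ⊥ᵖ , ⊢seqˡ d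

seqʳ : Pos Q → Pos (P ⨾ Q)
seqʳ (q , e) = ⊤ᵖ ⨾ᵖ q , ⊢seqʳ e

altˡ : Pos P → Pos (P ⊕ Q)
altˡ (p , d) = p ⊕ᵖ ⊥ᵖ , ⊢altˡ d

altʳ : Pos Q → Pos (P ⊕ Q)
altʳ (q , e) = ⊥ᵖ ⊕ᵖ q , ⊢altʳ e

par : Pos P → Pos Q → Pos (P ∥ Q)
par (p , d) (q , e) = (p ∥ᵖ q) , ⊢par d e

star : ℕ → Pos P → Pos (P ⋆)
star n (p , d) = p ^ᵖ n , ⊢star n d

-- Joins and meets

record IsJoin (x y j : Pos P) : Set where
  constructor isJoin
  field
    upperˡ : x ≤ₚ j
    upperʳ : y ≤ₚ j
    least : ∀ z → x ≤ₚ z → y ≤ₚ z → j ≤ₚ z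

record IsMeet (x y m : Pos P) : Set where
  constructor isMeet
  field
    lowerˡ : m ≤ₚ x
    lowerʳ : m ≤ₚ y
    greatest : ∀ z → z ≤ₚ x → z ≤ₚ y → z ≤ₚ m

Joins Meets : Prog Act → Set
Joins P = (x y : Pos P) → Σ (Pos P) (IsJoin x y)
Meets P = (x y : Pos P) → Σ (Pos P) (IsMeet x y)

join-≤ : {x y : Pos P} → x ≤ₚ y → IsJoin x y y
join-≤ x≤y = isJoin x≤y ≤-refl λ _ _ y≤z → y≤z

meet-≤ : {x y : Pos P} → x ≤ₚ y → IsMeet x y x
meet-≤ x≤y = isMeet ≤-refl x≤y λ _ z≤x _ → z≤x

IsJoin-comm : {x y j : Pos P} → IsJoin x y j → IsJoin y x j
IsJoin-comm (isJoin x≤j y≤j least) = isJoin y≤j x≤j λ z y≤z x≤z → least z x≤z y≤z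

IsMeet-comm : {x y m : Pos P} → IsMeet x y m → IsMeet y x m
IsMeet-comm (isMeet m≤x m≤y greatest) = isMeet m≤y m≤x λ z z≤y z≤x → greatest z z≤x z≤y

joins-act : ∀ {a : Act} → Joins (act a)
joins-act (_ , ⊢⊥) y = y , join-≤ ⊥≤
joins-act (_ , ⊢⊤) y = ⊤ₚ , IsJoin-comm (join-≤ ≤⊤)

meets-act : ∀ {a : Act} → Meets (act a)
meets-act (_ , ⊢⊥) y = ⊥ₚ , meet-≤ ⊥≤
meets-act (_ , ⊢⊤) y = y , IsMeet-comm (meet-≤ ≤⊤)

joins-⨾ : Joins P → Joins Q → Joins (P ⨾ Q)
joins-⨾ _ _ (_ , ⊢⊥) y = y , join-≤ ⊥≤
joins-⨾ _ _ (_ , ⊢⊤) y = ⊤ₚ , IsJoin-comm (join-≤ ≤⊤)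
joins-⨾ _ _ x (_ , ⊢⊥) = x , IsJoin-comm (join-≤ ⊥≤)
joins-⨾ _ _ x (_ , ⊢⊤) = ⊤ₚ , join-≤ ≤⊤
joins-⨾ _ _ (_ , ⊢seqˡ _) y@(_ , ⊢seqʳ _) = y , join-≤ (≤-seq ≤⊤ ⊥≤)
joins-⨾ _ _ x@(_ , ⊢seqʳ _) (_ , ⊢seqˡ _) = x , IsJoin-comm (join-≤ (≤-seq ≤⊤ ⊥≤))
joins-⨾ jP _ (_ , ⊢seqˡ d) (_ , ⊢seqˡ d') with jP (_ , d) (_ , d')
... | j , isJoin a b least = seqˡ j , isJoin (≤-seq a ≤-refl) (≤-seq b ≤-refl) λ where
  (_ , ⊢⊥) ()
  (_ , ⊢⊤) _ _ → ≤⊤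
  (_ , ⊢seqˡ e) h h' → ≤-seq (least (_ , e) (proj₁ (⨾ᵖ-≤-inv h)) (proj₁ (⨾ᵖ-≤-inv h'))) ≤-refl
  (_ , ⊢seqʳ e) _ _ → ≤-seq ≤⊤ ⊥≤
joins-⨾ _ jQ (_ , ⊢seqʳ e) (_ , ⊢seqʳ e') with jQ (_ , e) (_ , e')
... | j , isJoin a b least = seqʳ j , isJoin (≤-seq ≤-refl a) (≤-seq ≤-refl b) λ where
  (_ , ⊢⊥) ()
  (_ , ⊢⊤) _ _ → ≤⊤
  (_ , ⊢seqˡ f) h h' → ≤-seq (proj₁ (⨾ᵖ-≤-inv h)) (least ⊥ₚ (proj₂ (⨾ᵖ-≤-inv h)) (proj₂ (⨾ᵖ-≤-inv h')))
  (_ , ⊢seqʳ f) h h' → ≤-seq ≤-refl (least (_ , f) (proj₂ (⨾ᵖ-≤-inv h)) (proj₂ (⨾ᵖ-≤-inv h')))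

meets-⨾ : Meets P → Meets Q → Meets (P ⨾ Q)
meets-⨾ _ _ (_ , ⊢⊥) y = ⊥ₚ , meet-≤ ⊥≤
meets-⨾ _ _ (_ , ⊢⊤) y = y , IsMeet-comm (meet-≤ ≤⊤)
meets-⨾ _ _ x (_ , ⊢⊥) = ⊥ₚ , IsMeet-comm (meet-≤ ⊥≤)
meets-⨾ _ _ x (_ , ⊢⊤) = x , meet-≤ ≤⊤
meets-⨾ _ _ x@(_ , ⊢seqˡ _) (_ , ⊢seqʳ _) = x , meet-≤ (≤-seq ≤⊤ ⊥≤)
meets-⨾ _ _ (_ , ⊢seqʳ _) y@(_ , ⊢seqˡ _) = y , IsMeet-comm (meet-≤ (≤-seq ≤⊤ ⊥≤))
meets-⨾ mP _ (_ , ⊢seqˡ d) (_ , ⊢seqˡ d') with mP (_ , d) (_ , d')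
... | m , isMeet a b greatest = seqˡ m , isMeet (≤-seq a ≤-refl) (≤-seq b ≤-refl) λ where
  (_ , ⊢⊥) _ _ → ⊥≤
  (_ , ⊢⊤) () _
  (_ , ⊢seqˡ e) h h' → ≤-seq (greatest (_ , e) (proj₁ (⨾ᵖ-≤-inv h)) (proj₁ (⨾ᵖ-≤-inv h'))) ≤-refl
  (_ , ⊢seqʳ e) h h' → ≤-seq (greatest ⊤ₚ (proj₁ (⨾ᵖ-≤-inv h)) (proj₁ (⨾ᵖ-≤-inv h'))) (proj₂ (⨾ᵖ-≤-inv h))
meets-⨾ _ mQ (_ , ⊢seqʳ e) (_ , ⊢seqʳ e') with mQ (_ , e) (_ , e')
... | m , isMeet a b greatest = seqʳ m , isMeet (≤-seq ≤-refl a) (≤-seq ≤-refl b) λ where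
  (_ , ⊢⊥) _ _ → ⊥≤
  (_ , ⊢⊤) () _
  (_ , ⊢seqˡ f) _ _ → ≤-seq ≤⊤ ⊥≤
  (_ , ⊢seqʳ f) h h' → ≤-seq ≤-refl (greatest (_ , f) (proj₂ (⨾ᵖ-≤-inv h)) (proj₂ (⨾ᵖ-≤-inv h')))

-- p ⊕ ⊥ and ⊥ ⊕ q are comparable when one side is ⊥; otherwise only ⊤ bounds both.
join-altˡʳ : (x : Pos P) (y : Pos Q) → Σ (Pos (P ⊕ Q)) (IsJoin (altˡ x) (altʳ y))
join-altˡʳ (p , d) (q , e) with p ≟⊥ | q ≟⊥
... | yes refl | _ = altʳ (q , e) , join-≤ (≤-alt ≤-refl ⊥≤)
... | no _ | yes refl = altˡ (p , d) , IsJoin-comm (join-≤ (≤-alt ⊥≤ ≤-refl))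
... | no p≢⊥ | no q≢⊥ = ⊤ₚ , isJoin ≤⊤ ≤⊤ λ where
  (_ , ⊢⊥) ()
  (_ , ⊢⊤) _ _ → ≤-refl
  (_ , ⊢altˡ _) _ h' → ⊥-elim (q≢⊥ (≤⊥⇒≡⊥ (proj₂ (⊕ᵖ-≤-inv h'))))
  (_ , ⊢altʳ _) h _ → ⊥-elim (p≢⊥ (≤⊥⇒≡⊥ (proj₁ (⊕ᵖ-≤-inv h))))

meet-altˡʳ : (x : Pos P) (y : Pos Q) → IsMeet (altˡ x) (altʳ y) (altˡ ⊥ₚ)
meet-altˡʳ _ _ = isMeet (≤-alt ⊥≤ ≤-refl) (≤-alt ≤-refl ⊥≤) λ where
  (_ , ⊢⊥) _ _ → ⊥≤
  (_ , ⊢⊤) () _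
  (_ , ⊢altˡ _) _ h' → ≤-alt (proj₁ (⊕ᵖ-≤-inv h')) ≤-refl
  (_ , ⊢altʳ _) h _ → ≤-alt ≤-refl (proj₂ (⊕ᵖ-≤-inv h))

joins-⊕ : Joins P → Joins Q → Joins (P ⊕ Q)
joins-⊕ _ _ (_ , ⊢⊥) y = y , join-≤ ⊥≤
joins-⊕ _ _ (_ , ⊢⊤) y = ⊤ₚ , IsJoin-comm (join-≤ ≤⊤)
joins-⊕ _ _ x (_ , ⊢⊥) = x , IsJoin-comm (join-≤ ⊥≤)
joins-⊕ _ _ x (_ , ⊢⊤) = ⊤ₚ , join-≤ ≤⊤
joins-⊕ _ _ (_ , ⊢altˡ d) (_ , ⊢altʳ e) = join-altˡʳ (_ , d) (_ , e)
joins-⊕ _ _ (_ , ⊢altʳ e) (_ , ⊢altˡ d) with join-altˡʳ (_ , d) (_ , e)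
... | j , J = j , IsJoin-comm J
joins-⊕ jP _ (_ , ⊢altˡ d) (_ , ⊢altˡ d') with jP (_ , d) (_ , d')
... | j , isJoin a b least = altˡ j , isJoin (≤-alt a ≤-refl) (≤-alt b ≤-refl) λ where
  (_ , ⊢⊥) ()
  (_ , ⊢⊤) _ _ → ≤⊤
  (_ , ⊢altˡ e) h h' → ≤-alt (least (_ , e) (proj₁ (⊕ᵖ-≤-inv h)) (proj₁ (⊕ᵖ-≤-inv h'))) ≤-refl
  (_ , ⊢altʳ e) h h' → ≤-alt (least ⊥ₚ (proj₁ (⊕ᵖ-≤-inv h)) (proj₁ (⊕ᵖ-≤-inv h'))) ⊥≤
joins-⊕ _ jQ (_ , ⊢altʳ e) (_ , ⊢altʳ e') with jQ (_ , e) (_ , e')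
... | j , isJoin a b least = altʳ j , isJoin (≤-alt ≤-refl a) (≤-alt ≤-refl b) λ where
  (_ , ⊢⊥) ()
  (_ , ⊢⊤) _ _ → ≤⊤
  (_ , ⊢altˡ f) h h' → ≤-alt ⊥≤ (least ⊥ₚ (proj₂ (⊕ᵖ-≤-inv h)) (proj₂ (⊕ᵖ-≤-inv h')))
  (_ , ⊢altʳ f) h h' → ≤-alt ≤-refl (least (_ , f) (proj₂ (⊕ᵖ-≤-inv h)) (proj₂ (⊕ᵖ-≤-inv h')))

meets-⊕ : Meets P → Meets Q → Meets (P ⊕ Q)
meets-⊕ _ _ (_ , ⊢⊥) y = ⊥ₚ , meet-≤ ⊥≤
meets-⊕ _ _ (_ , ⊢⊤) y = y , IsMeet-comm (meet-≤ ≤⊤)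
meets-⊕ _ _ x (_ , ⊢⊥) = ⊥ₚ , IsMeet-comm (meet-≤ ⊥≤)
meets-⊕ _ _ x (_ , ⊢⊤) = x , meet-≤ ≤⊤
meets-⊕ _ _ (_ , ⊢altˡ d) (_ , ⊢altʳ e) = altˡ ⊥ₚ , meet-altˡʳ (_ , d) (_ , e)
meets-⊕ _ _ (_ , ⊢altʳ e) (_ , ⊢altˡ d) = altˡ ⊥ₚ , IsMeet-comm (meet-altˡʳ (_ , d) (_ , e))
meets-⊕ mP _ (_ , ⊢altˡ d) (_ , ⊢altˡ d') with mP (_ , d) (_ , d')
... | m , isMeet a b greatest = altˡ m , isMeet (≤-alt a ≤-refl) (≤-alt b ≤-refl) λ where
  (_ , ⊢⊥) _ _ → ⊥≤
  (_ , ⊢⊤) () _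
  (_ , ⊢altˡ e) h h' → ≤-alt (greatest (_ , e) (proj₁ (⊕ᵖ-≤-inv h)) (proj₁ (⊕ᵖ-≤-inv h'))) ≤-refl
  (_ , ⊢altʳ e) h _ → ≤-alt ⊥≤ (proj₂ (⊕ᵖ-≤-inv h))
meets-⊕ _ mQ (_ , ⊢altʳ e) (_ , ⊢altʳ e') with mQ (_ , e) (_ , e')
... | m , isMeet a b greatest = altʳ m , isMeet (≤-alt ≤-refl a) (≤-alt ≤-refl b) λ where
  (_ , ⊢⊥) _ _ → ⊥≤
  (_ , ⊢⊤) () _
  (_ , ⊢altˡ f) h _ → ≤-alt (proj₁ (⊕ᵖ-≤-inv h)) ⊥≤
  (_ , ⊢altʳ f) h h' → ≤-alt ≤-refl (greatest (_ , f) (proj₂ (⊕ᵖ-≤-inv h)) (proj₂ (⊕ᵖ-≤-inv h')))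

joins-∥ : Joins P → Joins Q → Joins (P ∥ Q)
joins-∥ _ _ (_ , ⊢⊥) y = y , join-≤ ⊥≤
joins-∥ _ _ (_ , ⊢⊤) y = ⊤ₚ , IsJoin-comm (join-≤ ≤⊤)
joins-∥ _ _ x (_ , ⊢⊥) = x , IsJoin-comm (join-≤ ⊥≤)
joins-∥ _ _ x (_ , ⊢⊤) = ⊤ₚ , join-≤ ≤⊤
joins-∥ jP jQ (_ , ⊢par d e) (_ , ⊢par d' e') with jP (_ , d) (_ , d') | jQ (_ , e) (_ , e')
... | j , isJoin a b least | j' , isJoin a' b' least' =
  par j j' , isJoin (≤-par a a') (≤-par b b') λ where
    (_ , ⊢⊥) ()
    (_ , ⊢⊤) _ _ → ≤⊤
    (_ , ⊢par f g) h h' → ≤-par (least (_ , f) (proj₁ (∥ᵖ-≤-inv h)) (proj₁ (∥ᵖ-≤-inv h')))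
                                 (least' (_ , g) (proj₂ (∥ᵖ-≤-inv h)) (proj₂ (∥ᵖ-≤-inv h')))

meets-∥ : Meets P → Meets Q → Meets (P ∥ Q)
meets-∥ _ _ (_ , ⊢⊥) y = ⊥ₚ , meet-≤ ⊥≤
meets-∥ _ _ (_ , ⊢⊤) y = y , IsMeet-comm (meet-≤ ≤⊤)
meets-∥ _ _ x (_ , ⊢⊥) = ⊥ₚ , IsMeet-comm (meet-≤ ⊥≤)
meets-∥ _ _ x (_ , ⊢⊤) = x , meet-≤ ≤⊤
meets-∥ mP mQ (_ , ⊢par d e) (_ , ⊢par d' e') with mP (_ , d) (_ , d') | mQ (_ , e) (_ , e')
... | m , isMeet a b greatest | m' , isMeet a' b' greatest' =
  par m m' , isMeet (≤-par a a') (≤-par b b') λ where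
    (_ , ⊢⊥) _ _ → ⊥≤
    (_ , ⊢⊤) () _
    (_ , ⊢par f g) h h' → ≤-par (greatest (_ , f) (proj₁ (∥ᵖ-≤-inv h)) (proj₁ (∥ᵖ-≤-inv h')))
                                 (greatest' (_ , g) (proj₂ (∥ᵖ-≤-inv h)) (proj₂ (∥ᵖ-≤-inv h')))

^ᵖ-least : ∀ {p q j r k} → (p ≤ᵖ r → q ≤ᵖ r → j ≤ᵖ r) →
           (p ^ᵖ n) ≤ᵖ (r ^ᵖ k) → (q ^ᵖ n) ≤ᵖ (r ^ᵖ k) → (j ^ᵖ n) ≤ᵖ (r ^ᵖ k)
^ᵖ-least least h h' with ^ᵖ-≤-inv h
... | inj₁ n<k = ≤-iter n<k
... | inj₂ (refl , p≤r) = ≤-star (least p≤r (^ᵖ-≤-base h'))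

^ᵖ-greatest : ∀ {p q m r k} → (r ≤ᵖ p → r ≤ᵖ q → r ≤ᵖ m) →
              (r ^ᵖ k) ≤ᵖ (p ^ᵖ n) → (r ^ᵖ k) ≤ᵖ (q ^ᵖ n) → (r ^ᵖ k) ≤ᵖ (m ^ᵖ n)
^ᵖ-greatest greatest h h' with ^ᵖ-≤-inv h
... | inj₁ k<n = ≤-iter k<n
... | inj₂ (refl , r≤p) = ≤-star (greatest r≤p (^ᵖ-≤-base h'))

joins-⋆ : Joins P → Joins (P ⋆)
joins-⋆ _ (_ , ⊢⊥) y = y , join-≤ ⊥≤
joins-⋆ _ (_ , ⊢⊤) y = ⊤ₚ , IsJoin-comm (join-≤ ≤⊤)
joins-⋆ _ x (_ , ⊢⊥) = x , IsJoin-comm (join-≤ ⊥≤)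
joins-⋆ _ x (_ , ⊢⊤) = ⊤ₚ , join-≤ ≤⊤
joins-⋆ jP x@(_ , ⊢star m d) y@(_ , ⊢star n d') with ℕₚ.<-cmp m n
... | tri< m<n _ _ = y , join-≤ (≤-iter m<n)
... | tri> _ _ n<m = x , IsJoin-comm (join-≤ (≤-iter n<m))
... | tri≈ _ refl _ with jP (_ , d) (_ , d')
...   | j , isJoin a b least = star n j , isJoin (≤-star a) (≤-star b) λ where
  (_ , ⊢⊥) ()
  (_ , ⊢⊤) _ _ → ≤⊤
  (_ , ⊢star k e) → ^ᵖ-least (least (_ , e))

meets-⋆ : Meets P → Meets (P ⋆)
meets-⋆ _ (_ , ⊢⊥) y = ⊥ₚ , meet-≤ ⊥≤
meets-⋆ _ (_ , ⊢⊤) y = y , IsMeet-comm (meet-≤ ≤⊤)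
meets-⋆ _ x (_ , ⊢⊥) = ⊥ₚ , IsMeet-comm (meet-≤ ⊥≤)
meets-⋆ _ x (_ , ⊢⊤) = x , meet-≤ ≤⊤
meets-⋆ mP x@(_ , ⊢star m d) y@(_ , ⊢star n d') with ℕₚ.<-cmp m n
... | tri< m<n _ _ = x , meet-≤ (≤-iter m<n)
... | tri> _ _ n<m = y , IsMeet-comm (meet-≤ (≤-iter n<m))
... | tri≈ _ refl _ with mP (_ , d) (_ , d')
...   | m , isMeet a b greatest = star n m , isMeet (≤-star a) (≤-star b) λ where
  (_ , ⊢⊥) _ _ → ⊥≤
  (_ , ⊢⊤) () _
  (_ , ⊢star k e) → ^ᵖ-greatest (greatest (_ , e))

joins : (P : Prog Act) → Joins P
joins (act a) = joins-act
joins (P ⨾ Q) = joins-⨾ (joins P) (joins Q)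
joins (P ⋆) = joins-⋆ (joins P)
joins (P ⊕ Q) = joins-⊕ (joins P) (joins Q)
joins (P ∥ Q) = joins-∥ (joins P) (joins Q)

meets : (P : Prog Act) → Meets P
meets (act a) = meets-act
meets (P ⨾ Q) = meets-⨾ (meets P) (meets Q)
meets (P ⋆) = meets-⋆ (meets P)
meets (P ⊕ Q) = meets-⊕ (meets P) (meets Q)
meets (P ∥ Q) = meets-∥ (meets P) (meets Q)

≤Pos-isPartialOrder : (P : Prog Act) → IsPartialOrder (_≈Pos_ P) (_≤Pos_ P)
≤Pos-isPartialOrder P = record
  { isPreorder = record
    { isEquivalence = record { refl = refl ; sym = sym ; trans = trans }
    ; reflexive = λ { refl → ≤-refl }
    ; trans = ≤ᵖ-trans
    }
  ; antisym = ≤ᵖ-antisym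
  }

isLatticeOrder : (P : Prog Act) → OrderNotions.IsLatticeOrder (_≈Pos_ P) (_≤Pos_ P)
isLatticeOrder P = (λ x y → proj₁ (joins P x y)) , (λ x y → proj₁ (meets P x y)) , record
  { isPartialOrder = ≤Pos-isPartialOrder P
  ; supremum = λ x y → let open IsJoin (proj₂ (joins P x y)) in upperˡ , upperʳ , least
  ; infimum = λ x y → let open IsMeet (proj₂ (meets P x y)) in lowerˡ , lowerʳ , greatest
  }

-- Complement bases

record UpperComplementBasis {X : Set} (_≤_ : Rel X 0ℓ) (y : X) : Set where
  constructor upperComplementBasis
  field
    basis : List X
    basis-≰ : All (λ w → ¬ w ≤ y) basis
    ≤-or-above : ∀ z → z ≤ y ⊎ Any (_≤ z) basis

LowerComplementBasis : {X : Set} → Rel X 0ℓ → X → Set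
LowerComplementBasis _≤_ = UpperComplementBasis (flip _≤_)

pattern lowerComplementBasis B B≱y split = upperComplementBasis B B≱y split

module _ {X : Set} {_≤_ : Rel X 0ℓ} (≤-trans : Transitive _≤_) where

  above-basis⇒≰ : ∀ {y z} (b : UpperComplementBasis _≤_ y) →
                  Any (_≤ z) (UpperComplementBasis.basis b) → ¬ z ≤ y
  above-basis⇒≰ b above z≤y =
    All.lookupWith (λ w≰y w≤z → w≰y (≤-trans w≤z z≤y)) (UpperComplementBasis.basis-≰ b) above

  upperComplementBases⇒decidable : (∀ y → UpperComplementBasis _≤_ y) → Decidable _≤_
  upperComplementBases⇒decidable bases z y with UpperComplementBasis.≤-or-above (bases y) z
  ... | inj₁ z≤y = yes z≤y
  ... | inj₂ above = no (above-basis⇒≰ (bases y) above)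

  upperComplementBasis⇒finitelyUpperComplemented : ∀ {_≈_ : Rel X 0ℓ} {y} →
    UpperComplementBasis _≤_ y → OrderNotions.FinitelyUpperComplemented _≈_ _≤_ y
  upperComplementBasis⇒finitelyUpperComplemented b@(upperComplementBasis B _ split) = B , λ z → mk⇔
    (λ z≰y → [ (λ z≤y → ⊥-elim (z≰y z≤y)) , id ]′ (split z))
    (above-basis⇒≰ b)

lowerComplementBasis⇒finitelyLowerComplemented : {X : Set} {_≈_ _≤_ : Rel X 0ℓ} → Transitive _≤_ →
  ∀ {y} → LowerComplementBasis _≤_ y → OrderNotions.FinitelyLowerComplemented _≈_ _≤_ y
lowerComplementBasis⇒finitelyLowerComplemented {_≈_ = _≈_} ≤-trans =
  upperComplementBasis⇒finitelyUpperComplemented (λ x≥y y≥z → ≤-trans y≥z x≥y) {_≈_ = _≈_}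

UpperBasis LowerBasis : Pos P → Set
UpperBasis = UpperComplementBasis _≤ₚ_
LowerBasis = LowerComplementBasis _≤ₚ_

UpperBases : Prog Act → Set
UpperBases P = (y : Pos P) → UpperBasis y

⊤-upperBasis : UpperBasis (⊤ₚ {P = P})
⊤-upperBasis = upperComplementBasis [] [] λ _ → inj₁ ≤⊤

upperBases-act : ∀ {a : Act} → UpperBases (act a)
upperBases-act (_ , ⊢⊤) = ⊤-upperBasis
upperBases-act (_ , ⊢⊥) = upperComplementBasis (⊤ₚ ∷ []) ((λ ()) ∷ []) λ where
  (_ , ⊢⊥) → inj₁ ≤-refl
  (_ , ⊢⊤) → inj₂ (here ≤-refl)

upperBases-⨾ : UpperBases P → UpperBases Q → UpperBases (P ⨾ Q)
upperBases-⨾ _ _ (_ , ⊢⊤) = ⊤-upperBasis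
upperBases-⨾ _ _ (_ , ⊢⊥) = upperComplementBasis (seqˡ ⊥ₚ ∷ []) ((λ ()) ∷ []) λ where
  (_ , ⊢⊥) → inj₁ ≤-refl
  (_ , ⊢⊤) → inj₂ (here ≤⊤)
  (_ , ⊢seqˡ _) → inj₂ (here (≤-seq ⊥≤ ≤-refl))
  (_ , ⊢seqʳ _) → inj₂ (here (≤-seq ⊥≤ ⊥≤))
upperBases-⨾ bP bQ (_ , ⊢seqˡ d) with bP (_ , d) | bQ ⊥ₚ
... | upperComplementBasis B B≰ split | upperComplementBasis C C≰ splitQ =
  upperComplementBasis (map seqˡ B ++ map seqʳ C)
    (All.++⁺ (All.gmap⁺ (λ w≰ h → w≰ (proj₁ (⨾ᵖ-≤-inv h))) B≰)
             (All.gmap⁺ (λ w≰ h → w≰ (proj₂ (⨾ᵖ-≤-inv h))) C≰))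
    λ where
      (_ , ⊢⊥) → inj₁ ⊥≤
      (_ , ⊢⊤) → [ (λ ()) , (λ a → inj₂ (Any.++⁺ʳ (map seqˡ B) (Any.gmap (λ _ → ≤⊤) a))) ]′ (splitQ ⊤ₚ)
      (_ , ⊢seqˡ e) → Sum.map (λ h → ≤-seq h ≤-refl) (λ a → Any.++⁺ˡ (Any.gmap (λ h → ≤-seq h ≤-refl) a))
                              (split (_ , e))
      (_ , ⊢seqʳ e) →
        [ (λ ⊤≤p → Sum.map (≤-seq ⊤≤p) (λ a → Any.++⁺ʳ (map seqˡ B) (Any.gmap (≤-seq ≤-refl) a))
                            (splitQ (_ , e)))
        , (λ a → inj₂ (Any.++⁺ˡ (Any.gmap (λ _ → ≤-seq ≤⊤ ⊥≤) a))) ]′ (split ⊤ₚ)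
upperBases-⨾ _ bQ (_ , ⊢seqʳ e) with bQ (_ , e)
... | upperComplementBasis C C≰ split =
  upperComplementBasis (map seqʳ C ++ ⊤ₚ ∷ [])
    (All.++⁺ (All.gmap⁺ (λ w≰ h → w≰ (proj₂ (⨾ᵖ-≤-inv h))) C≰) ((λ ()) ∷ []))
    λ where
      (_ , ⊢⊥) → inj₁ ⊥≤
      (_ , ⊢⊤) → inj₂ (Any.++⁺ʳ (map seqʳ C) (here ≤-refl))
      (_ , ⊢seqˡ _) → inj₁ (≤-seq ≤⊤ ⊥≤)
      (_ , ⊢seqʳ f) → Sum.map (≤-seq ≤-refl) (λ a → Any.++⁺ˡ (Any.gmap (≤-seq ≤-refl) a)) (split (_ , f))

upperBases-⊕ : UpperBases P → UpperBases Q → UpperBases (P ⊕ Q)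
upperBases-⊕ _ _ (_ , ⊢⊤) = ⊤-upperBasis
upperBases-⊕ _ _ (_ , ⊢⊥) = upperComplementBasis (altˡ ⊥ₚ ∷ []) ((λ ()) ∷ []) λ where
  (_ , ⊢⊥) → inj₁ ≤-refl
  (_ , ⊢⊤) → inj₂ (here ≤⊤)
  (_ , ⊢altˡ _) → inj₂ (here (≤-alt ⊥≤ ≤-refl))
  (_ , ⊢altʳ _) → inj₂ (here (≤-alt ≤-refl ⊥≤))
upperBases-⊕ bP bQ (_ , ⊢altˡ d) with bP (_ , d) | bQ ⊥ₚ
... | upperComplementBasis B B≰ split | upperComplementBasis C C≰ splitQ =
  upperComplementBasis (map altˡ B ++ map altʳ C)
    (All.++⁺ (All.gmap⁺ (λ w≰ h → w≰ (proj₁ (⊕ᵖ-≤-inv h))) B≰)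
             (All.gmap⁺ (λ w≰ h → w≰ (proj₂ (⊕ᵖ-≤-inv h))) C≰))
    λ where
      (_ , ⊢⊥) → inj₁ ⊥≤
      (_ , ⊢⊤) → [ (λ ()) , (λ a → inj₂ (Any.++⁺ʳ (map altˡ B) (Any.gmap (λ _ → ≤⊤) a))) ]′ (splitQ ⊤ₚ)
      (_ , ⊢altˡ e) → Sum.map (λ h → ≤-alt h ≤-refl) (λ a → Any.++⁺ˡ (Any.gmap (λ h → ≤-alt h ≤-refl) a))
                              (split (_ , e))
      (_ , ⊢altʳ f) → Sum.map (≤-alt ⊥≤) (λ a → Any.++⁺ʳ (map altˡ B) (Any.gmap (≤-alt ≤-refl) a))
                              (splitQ (_ , f))
upperBases-⊕ bP bQ (_ , ⊢altʳ e) with bQ (_ , e) | bP ⊥ₚ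
... | upperComplementBasis C C≰ split | upperComplementBasis B B≰ splitP =
  upperComplementBasis (map altʳ C ++ map altˡ B)
    (All.++⁺ (All.gmap⁺ (λ w≰ h → w≰ (proj₂ (⊕ᵖ-≤-inv h))) C≰)
             (All.gmap⁺ (λ w≰ h → w≰ (proj₁ (⊕ᵖ-≤-inv h))) B≰))
    λ where
      (_ , ⊢⊥) → inj₁ ⊥≤
      (_ , ⊢⊤) → [ (λ ()) , (λ a → inj₂ (Any.++⁺ʳ (map altʳ C) (Any.gmap (λ _ → ≤⊤) a))) ]′ (splitP ⊤ₚ)
      (_ , ⊢altʳ f) → Sum.map (≤-alt ≤-refl) (λ a → Any.++⁺ˡ (Any.gmap (≤-alt ≤-refl) a)) (split (_ , f))
      (_ , ⊢altˡ d) → Sum.map (λ h → ≤-alt h ⊥≤)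
                              (λ a → Any.++⁺ʳ (map altʳ C) (Any.gmap (λ h → ≤-alt h ≤-refl) a))
                              (splitP (_ , d))

upperBases-∥ : UpperBases P → UpperBases Q → UpperBases (P ∥ Q)
upperBases-∥ _ _ (_ , ⊢⊤) = ⊤-upperBasis
upperBases-∥ _ _ (_ , ⊢⊥) = upperComplementBasis (par ⊥ₚ ⊥ₚ ∷ []) ((λ ()) ∷ []) λ where
  (_ , ⊢⊥) → inj₁ ≤-refl
  (_ , ⊢⊤) → inj₂ (here ≤⊤)
  (_ , ⊢par _ _) → inj₂ (here (≤-par ⊥≤ ⊥≤))
upperBases-∥ bP bQ (_ , ⊢par d e) with bP (_ , d) | bQ (_ , e)
... | upperComplementBasis B B≰ splitP | upperComplementBasis C C≰ splitQ =
  upperComplementBasis (map (λ w → par w ⊥ₚ) B ++ map (par ⊥ₚ) C ++ ⊤ₚ ∷ [])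
    (All.++⁺ (All.gmap⁺ (λ w≰ h → w≰ (proj₁ (∥ᵖ-≤-inv h))) B≰)
             (All.++⁺ (All.gmap⁺ (λ w≰ h → w≰ (proj₂ (∥ᵖ-≤-inv h))) C≰) ((λ ()) ∷ [])))
    λ where
      (_ , ⊢⊥) → inj₁ ⊥≤
      (_ , ⊢⊤) → inj₂ (Any.++⁺ʳ (map (λ w → par w ⊥ₚ) B) (Any.++⁺ʳ (map (par ⊥ₚ) C) (here ≤-refl)))
      (_ , ⊢par f g) →
        [ (λ f≤p → Sum.map (≤-par f≤p)
                     (λ a → Any.++⁺ʳ (map (λ w → par w ⊥ₚ) B) (Any.++⁺ˡ (Any.gmap (≤-par ⊥≤) a)))
                     (splitQ (_ , g)))
        , (λ a → inj₂ (Any.++⁺ˡ (Any.gmap (λ h → ≤-par h ⊥≤) a))) ]′ (splitP (_ , f))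

upperBases-⋆ : UpperBases P → UpperBases (P ⋆)
upperBases-⋆ _ (_ , ⊢⊤) = ⊤-upperBasis
upperBases-⋆ _ (_ , ⊢⊥) = upperComplementBasis (star 0 ⊥ₚ ∷ []) ((λ ()) ∷ []) λ where
  (_ , ⊢⊥) → inj₁ ≤-refl
  (_ , ⊢⊤) → inj₂ (here ≤⊤)
  (_ , ⊢star _ _) → inj₂ (here (^ᵖ-mono z≤n ⊥≤))
upperBases-⋆ {P = P} bP (_ , ⊢star {p = p} n d) =
  upperComplementBasis (map (star n) B ++ star (suc n) ⊥ₚ ∷ [])
  (All.++⁺ (All.gmap⁺ (λ w≰ h → w≰ (^ᵖ-≤-base h)) B≰) ((λ h → ℕₚ.1+n≰n (^ᵖ-≤-exponent h)) ∷ []))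
  λ where
    (_ , ⊢⊥) → inj₁ ⊥≤
    (_ , ⊢⊤) → inj₂ (Any.++⁺ʳ (map (star n) B) (here ≤⊤))
    (_ , ⊢star k e) → split-star e (ℕₚ.<-cmp k n)
  where
  open UpperComplementBasis (bP (_ , d)) renaming (basis to B; basis-≰ to B≰; ≤-or-above to split)
  split-star : ∀ {k r} (e : P ⊢ r) → Tri (k < n) (k ≡ n) (n < k) →
    (r ^ᵖ k) ≤ᵖ (p ^ᵖ n) ⊎ Any (_≤ₚ star k (r , e)) (map (star n) B ++ star (suc n) ⊥ₚ ∷ [])
  split-star e (tri< k<n _ _) = inj₁ (≤-iter k<n)
  split-star e (tri≈ _ refl _) = Sum.map ≤-star (λ a → Any.++⁺ˡ (Any.gmap ≤-star a)) (split (_ , e))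
  split-star e (tri> _ _ n<k) = inj₂ (Any.++⁺ʳ (map (star n) B) (here (^ᵖ-mono n<k ⊥≤)))

upperBases : (P : Prog Act) → UpperBases P
upperBases (act a) = upperBases-act
upperBases (P ⨾ Q) = upperBases-⨾ (upperBases P) (upperBases Q)
upperBases (P ⋆) = upperBases-⋆ (upperBases P)
upperBases (P ⊕ Q) = upperBases-⊕ (upperBases P) (upperBases Q)
upperBases (P ∥ Q) = upperBases-∥ (upperBases P) (upperBases Q)

_≤ₚ?_ : Decidable (_≤ₚ_ {P = P})
_≤ₚ?_ {P = P} = upperComplementBases⇒decidable ≤ᵖ-trans (upperBases P)

-- Almost-full relations (Vytiniotis, Coquand and Wahlstedt): an inductive, constructive
-- presentation of well-quasi-orders.

data AlmostFull {A : Set} : Rel A 0ℓ → Set₁ where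
  now : ∀ {R} → (∀ x y → R x y) → AlmostFull R
  later : ∀ {R} → (∀ x → AlmostFull (λ y z → R y z ⊎ R x y)) → AlmostFull R

⊎-merge : ∀ {S U V : Set} → S ⊎ U → S ⊎ V → S ⊎ (U × V)
⊎-merge (inj₁ s) _ = inj₁ s
⊎-merge (inj₂ _) (inj₁ s) = inj₁ s
⊎-merge (inj₂ u) (inj₂ v) = inj₂ (u , v)

module _ {A : Set} where

  almostFull⇒good : ∀ {R : Rel A 0ℓ} → AlmostFull R → (f : ℕ → A) →
                    Σ ℕ λ i → Σ ℕ λ j → i < j × R (f i) (f j)
  almostFull⇒good (now r) f = 0 , 1 , s≤s z≤n , r (f 0) (f 1)
  almostFull⇒good (later g) f with almostFull⇒good (g (f 0)) (λ n → f (suc n))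
  ... | i , j , i<j , inj₁ r = suc i , suc j , s≤s i<j , r
  ... | i , _ , _ , inj₂ r = 0 , suc i , s≤s z≤n , r

  almostFull-pullback : ∀ {B : Set} {R : Rel A 0ℓ} {S : Rel B 0ℓ} (f : B → A) →
                        (∀ x y → R (f x) (f y) → S x y) → AlmostFull R → AlmostFull S
  almostFull-pullback f h (now r) = now λ x y → h x y (r (f x) (f y))
  almostFull-pullback f h (later g) =
    later λ x → almostFull-pullback f (λ y z → Sum.map (h y z) (h x y)) (g (f x))

  almostFull-mono : ∀ {R S : Rel A 0ℓ} → (∀ {x y} → R x y → S x y) → AlmostFull R → AlmostFull S
  almostFull-mono h = almostFull-pullback id (λ _ _ → h)

  -- Allowing S to fail where both exceptions U and V hold is what makes the double induction
  -- in almostFull-∩ go through; deciding U x and V x replaces a classical case split.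
  almostFull-except : ∀ {U V : A → Set} {Q₁ Q₂ S : Rel A 0ℓ} →
    (∀ x → Dec (U x)) → (∀ x → Dec (V x)) → AlmostFull Q₁ → AlmostFull Q₂ →
    (∀ {y z} → Q₁ y z → S y z ⊎ U y) → (∀ {y z} → Q₂ y z → S y z ⊎ V y) →
    AlmostFull (λ y z → S y z ⊎ (U y × V y))
  almostFull-except _ _ (now q₁) a₂ h₁ h₂ =
    almostFull-mono (λ q₂ → ⊎-merge (h₁ (q₁ _ _)) (h₂ q₂)) a₂
  almostFull-except _ _ a₁@(later _) (now q₂) h₁ h₂ =
    almostFull-mono (λ q₁ → ⊎-merge (h₁ q₁) (h₂ (q₂ _ _))) a₁
  almostFull-except {U} {V} {S = S} U? V? a₁@(later g₁) a₂@(later g₂) h₁ h₂ = later λ x →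
    step x (U? x) (V? x)
      (λ ¬ux → almostFull-except U? V? (g₁ x) a₂ (extend h₁ ¬ux) (λ q → Sum.map₁ inj₁ (h₂ q)))
      (λ ¬vx → almostFull-except U? V? a₁ (g₂ x) (λ q → Sum.map₁ inj₁ (h₁ q)) (extend h₂ ¬vx))
    where
    extend : ∀ {W : A → Set} {Q : Rel A 0ℓ} {x y z} → (∀ {y z} → Q y z → S y z ⊎ W y) → ¬ W x →
             Q y z ⊎ Q x y → (S y z ⊎ S x y) ⊎ W y
    extend h _ (inj₁ q) = Sum.map₁ inj₁ (h q)
    extend h ¬wx (inj₂ q) = inj₁ (inj₂ ([ id , (λ wx → ⊥-elim (¬wx wx)) ]′ (h q)))
    reassoc : ∀ {x y z} → (S y z ⊎ S x y) ⊎ (U y × V y) → (S y z ⊎ (U y × V y)) ⊎ (S x y ⊎ (U x × V x))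
    reassoc (inj₁ (inj₁ s)) = inj₁ (inj₁ s)
    reassoc (inj₁ (inj₂ s)) = inj₂ (inj₁ s)
    reassoc (inj₂ uv) = inj₁ (inj₂ uv)
    Reduced : A → Set₁
    Reduced x = AlmostFull (λ y z → (S y z ⊎ S x y) ⊎ (U y × V y))
    step : ∀ x → Dec (U x) → Dec (V x) → (¬ U x → Reduced x) → (¬ V x → Reduced x) →
           AlmostFull (λ y z → (S y z ⊎ (U y × V y)) ⊎ (S x y ⊎ (U x × V x)))
    step x (yes ux) (yes vx) _ _ = now λ _ _ → inj₂ (inj₂ (ux , vx))
    step x (no ¬ux) _ without-u _ = almostFull-mono reassoc (without-u ¬ux)
    step x (yes _) (no ¬vx) _ without-v = almostFull-mono reassoc (without-v ¬vx)

  almostFull-∩ : ∀ {R T : Rel A 0ℓ} → Decidable R → Decidable T →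
                 AlmostFull R → AlmostFull T → AlmostFull (λ y z → R y z × T y z)
  almostFull-∩ _ _ (now r) t = almostFull-mono (λ t' → r _ _ , t') t
  almostFull-∩ _ _ r@(later _) (now t) = almostFull-mono (λ r' → r' , t _ _) r
  almostFull-∩ R? T? (later g) (later h) = later λ x →
    almostFull-except (R? x) (T? x)
      (almostFull-∩ (λ y z → R? y z ⊎-dec R? x y) T? (g x) (later h))
      (almostFull-∩ R? (λ y z → T? y z ⊎-dec T? x y) (later g) (h x))
      (λ { (inj₁ r , t) → inj₁ (r , t) ; (inj₂ r , _) → inj₂ r })
      (λ { (r , inj₁ t) → inj₁ (r , t) ; (_ , inj₂ t) → inj₂ t })

almostFull-× : ∀ {A B : Set} {R : Rel A 0ℓ} {S : Rel B 0ℓ} → Decidable R → Decidable S →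
               AlmostFull R → AlmostFull S → AlmostFull (Pointwise R S)
almostFull-× R? S? r s = almostFull-∩ (λ x y → R? (proj₁ x) (proj₁ y)) (λ x y → S? (proj₂ x) (proj₂ y))
  (almostFull-pullback proj₁ (λ _ _ → id) r) (almostFull-pullback proj₂ (λ _ _ → id) s)

≤-almostFull : AlmostFull ℕ._≤_
≤-almostFull = later λ n → above n (<-wellFounded n)
  where
  above : ∀ n → Acc _<_ n → AlmostFull (λ y z → y ≤ z ⊎ n ≤ y)
  above n (acc rs) = later λ x → step x (n ℕ.≤? x)
    where
    step : ∀ x → Dec (n ≤ x) → AlmostFull (λ y z → (y ≤ z ⊎ n ≤ y) ⊎ (x ≤ y ⊎ n ≤ x))
    step x (yes n≤x) = now λ _ _ → inj₂ (inj₂ n≤x)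
    step x (no n≰x) = almostFull-mono (Sum.map inj₁ inj₁) (above x (rs (ℕₚ.≰⇒> n≰x)))

-- Well-order

Tagged : ∀ {A B : Set} → Rel A 0ℓ → Rel B 0ℓ → Rel (ℕ × A × B) 0ℓ
Tagged R S = Pointwise ℕ._≤_ (Pointwise R S)

almostFull-tagged : ∀ {A B : Set} {R : Rel A 0ℓ} {S : Rel B 0ℓ} → Decidable R → Decidable S →
                    AlmostFull R → AlmostFull S → AlmostFull (Tagged R S)
almostFull-tagged R? S? r s =
  almostFull-× ℕ._≤?_ (×-decidable R? S?) ≤-almostFull (almostFull-× R? S? r s)

AlmostFullPos : Prog Act → Set₁
AlmostFullPos P = AlmostFull (_≤ₚ_ {P = P})

almostFull-act : ∀ {a : Act} → AlmostFullPos (act a)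
almostFull-act = almostFull-pullback code sound ≤-almostFull
  where
  code : Pos (act _) → ℕ
  code (_ , ⊢⊥) = 0
  code (_ , ⊢⊤) = 1
  sound : ∀ x y → code x ≤ code y → x ≤ₚ y
  sound (_ , ⊢⊥) _ _ = ⊥≤
  sound (_ , ⊢⊤) (_ , ⊢⊤) _ = ≤-refl
  sound (_ , ⊢⊤) (_ , ⊢⊥) ()

almostFull-⨾ : AlmostFullPos P → AlmostFullPos Q → AlmostFullPos (P ⨾ Q)
almostFull-⨾ {P = P} {Q = Q} afP afQ =
  almostFull-pullback code sound (almostFull-tagged _≤ₚ?_ _≤ₚ?_ afP afQ)
  where
  code : Pos (P ⨾ Q) → ℕ × Pos P × Pos Q
  code (_ , ⊢⊥) = 0 , ⊥ₚ , ⊥ₚ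
  code (_ , ⊢seqˡ d) = 1 , (_ , d) , ⊥ₚ
  code (_ , ⊢seqʳ e) = 2 , ⊤ₚ , (_ , e)
  code (_ , ⊢⊤) = 3 , ⊤ₚ , ⊤ₚ
  sound : ∀ x y → Tagged _≤ₚ_ _≤ₚ_ (code x) (code y) → x ≤ₚ y
  sound (_ , ⊢⊥) _ _ = ⊥≤
  sound _ (_ , ⊢⊤) _ = ≤⊤
  sound (_ , ⊢seqˡ _) (_ , ⊢seqˡ _) (_ , p≤p' , _) = ≤-seq p≤p' ≤-refl
  sound (_ , ⊢seqˡ _) (_ , ⊢seqʳ _) _ = ≤-seq ≤⊤ ⊥≤
  sound (_ , ⊢seqʳ _) (_ , ⊢seqʳ _) (_ , _ , q≤q') = ≤-seq ≤-refl q≤q'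
  sound (_ , ⊢seqˡ _) (_ , ⊢⊥) (() , _)
  sound (_ , ⊢seqʳ _) (_ , ⊢⊥) (() , _)
  sound (_ , ⊢⊤) (_ , ⊢⊥) (() , _)
  sound (_ , ⊢seqʳ _) (_ , ⊢seqˡ _) (s≤s () , _)
  sound (_ , ⊢⊤) (_ , ⊢seqˡ _) (s≤s () , _)
  sound (_ , ⊢⊤) (_ , ⊢seqʳ _) (s≤s (s≤s ()) , _)

-- Left and right alternatives share one tag: (p , ⊥) ≤ (⊥ , q) forces p ≤ ⊥, and then p ⊕ ⊥ ≤ ⊥ ⊕ q.
almostFull-⊕ : AlmostFullPos P → AlmostFullPos Q → AlmostFullPos (P ⊕ Q)
almostFull-⊕ {P = P} {Q = Q} afP afQ =
  almostFull-pullback code sound (almostFull-tagged _≤ₚ?_ _≤ₚ?_ afP afQ)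
  where
  code : Pos (P ⊕ Q) → ℕ × Pos P × Pos Q
  code (_ , ⊢⊥) = 0 , ⊥ₚ , ⊥ₚ
  code (_ , ⊢altˡ d) = 1 , (_ , d) , ⊥ₚ
  code (_ , ⊢altʳ e) = 1 , ⊥ₚ , (_ , e)
  code (_ , ⊢⊤) = 2 , ⊤ₚ , ⊤ₚ
  sound : ∀ x y → Tagged _≤ₚ_ _≤ₚ_ (code x) (code y) → x ≤ₚ y
  sound (_ , ⊢⊥) _ _ = ⊥≤
  sound _ (_ , ⊢⊤) _ = ≤⊤
  sound (_ , ⊢altˡ _) (_ , ⊢altˡ _) (_ , p≤p' , _) = ≤-alt p≤p' ≤-refl
  sound (_ , ⊢altˡ _) (_ , ⊢altʳ _) (_ , p≤⊥ , _) = ≤-alt p≤⊥ ⊥≤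
  sound (_ , ⊢altʳ _) (_ , ⊢altˡ _) (_ , _ , q≤⊥) = ≤-alt ⊥≤ q≤⊥
  sound (_ , ⊢altʳ _) (_ , ⊢altʳ _) (_ , _ , q≤q') = ≤-alt ≤-refl q≤q'
  sound (_ , ⊢altˡ _) (_ , ⊢⊥) (() , _)
  sound (_ , ⊢altʳ _) (_ , ⊢⊥) (() , _)
  sound (_ , ⊢⊤) (_ , ⊢⊥) (() , _)
  sound (_ , ⊢⊤) (_ , ⊢altˡ _) (s≤s () , _)
  sound (_ , ⊢⊤) (_ , ⊢altʳ _) (s≤s () , _)

almostFull-∥ : AlmostFullPos P → AlmostFullPos Q → AlmostFullPos (P ∥ Q)
almostFull-∥ {P = P} {Q = Q} afP afQ =
  almostFull-pullback code sound (almostFull-tagged _≤ₚ?_ _≤ₚ?_ afP afQ)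
  where
  code : Pos (P ∥ Q) → ℕ × Pos P × Pos Q
  code (_ , ⊢⊥) = 0 , ⊥ₚ , ⊥ₚ
  code (_ , ⊢par d e) = 1 , (_ , d) , (_ , e)
  code (_ , ⊢⊤) = 2 , ⊤ₚ , ⊤ₚ
  sound : ∀ x y → Tagged _≤ₚ_ _≤ₚ_ (code x) (code y) → x ≤ₚ y
  sound (_ , ⊢⊥) _ _ = ⊥≤
  sound _ (_ , ⊢⊤) _ = ≤⊤
  sound (_ , ⊢par _ _) (_ , ⊢par _ _) (_ , p≤p' , q≤q') = ≤-par p≤p' q≤q'
  sound (_ , ⊢par _ _) (_ , ⊢⊥) (() , _)
  sound (_ , ⊢⊤) (_ , ⊢⊥) (() , _)
  sound (_ , ⊢⊤) (_ , ⊢par _ _) (s≤s () , _)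

almostFull-⋆ : AlmostFullPos P → AlmostFullPos (P ⋆)
almostFull-⋆ {P = P} afP =
  almostFull-pullback code sound (almostFull-tagged ℕ._≤?_ _≤ₚ?_ ≤-almostFull afP)
  where
  code : Pos (P ⋆) → ℕ × ℕ × Pos P
  code (_ , ⊢⊥) = 0 , 0 , ⊥ₚ
  code (_ , ⊢star n d) = 1 , n , (_ , d)
  code (_ , ⊢⊤) = 2 , 0 , ⊤ₚ
  sound : ∀ x y → Tagged ℕ._≤_ _≤ₚ_ (code x) (code y) → x ≤ₚ y
  sound (_ , ⊢⊥) _ _ = ⊥≤
  sound _ (_ , ⊢⊤) _ = ≤⊤
  sound (_ , ⊢star _ _) (_ , ⊢star _ _) (_ , m≤n , p≤p') = ^ᵖ-mono m≤n p≤p'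
  sound (_ , ⊢star _ _) (_ , ⊢⊥) (() , _)
  sound (_ , ⊢⊤) (_ , ⊢⊥) (() , _)
  sound (_ , ⊢⊤) (_ , ⊢star _ _) (s≤s () , _)

almostFullPos : (P : Prog Act) → AlmostFullPos P
almostFullPos (act a) = almostFull-act
almostFullPos (P ⨾ Q) = almostFull-⨾ (almostFullPos P) (almostFullPos Q)
almostFullPos (P ⋆) = almostFull-⋆ (almostFullPos P)
almostFullPos (P ⊕ Q) = almostFull-⊕ (almostFullPos P) (almostFullPos Q)
almostFullPos (P ∥ Q) = almostFull-∥ (almostFullPos P) (almostFullPos Q)

isWellOrder : (P : Prog Act) → OrderNotions.IsWellOrder (_≈Pos_ P) (_≤Pos_ P)
isWellOrder P = almostFull⇒good (almostFullPos P)

-- Lower complement bases of minimal elements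

record MinimalOutside (x y : Pos P) : Set where
  constructor minimalOutside
  field
    outside : ¬ y ≤ₚ x
    minimal : ∀ z → ¬ z ≤ₚ x → z ≤ₚ y → proj₁ z ≡ proj₁ y

LowerBasesOfMinimal : Prog Act → Set
LowerBasesOfMinimal P = (x y : Pos P) → MinimalOutside x y → LowerBasis y

lowerBasis-≈ : {x y : Pos P} → proj₁ x ≡ proj₁ y → LowerBasis x → LowerBasis y
lowerBasis-≈ {x = _ , _} {y = _ , _} refl (lowerComplementBasis B B≱x split) =
  lowerComplementBasis B B≱x split

⊥-lowerBasis : ∀ {d : P ⊢ ⊥ᵖ} → LowerBasis (⊥ᵖ , d)
⊥-lowerBasis = lowerComplementBasis [] [] λ _ → inj₁ ⊥≤

minimalOutside-≈ : {x y y' : Pos P} → proj₁ y ≡ proj₁ y' → MinimalOutside x y → MinimalOutside x y'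
minimalOutside-≈ {y = _ , _} {y' = _ , _} refl (minimalOutside y≰x minimal) = minimalOutside y≰x minimal

record IsEmbedding (e : Pos Q → Pos P) : Set where
  field
    monotone : ∀ a b → a ≤ₚ b → e a ≤ₚ e b
    injective : ∀ a b → proj₁ (e a) ≡ proj₁ (e b) → proj₁ a ≡ proj₁ b

minimalOutside-reflect : ∀ {e : Pos Q → Pos P} → IsEmbedding e → {x : Pos P} (x' y : Pos Q) →
  (∀ a → e a ≤ₚ x → a ≤ₚ x') → ¬ y ≤ₚ x' → MinimalOutside x (e y) → MinimalOutside x' y
minimalOutside-reflect {e = e} emb x' y reflect y≰x' (minimalOutside _ minimal) =
  minimalOutside y≰x' λ z z≰x' z≤y →
    injective z y (minimal (e z) (λ ez≤x → z≰x' (reflect z ez≤x)) (monotone z y z≤y))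
  where open IsEmbedding emb

seqˡ-embedding : IsEmbedding (seqˡ {P = P} {Q = Q})
seqˡ-embedding = record { monotone = λ _ _ h → ≤-seq h ≤-refl ; injective = λ { _ _ refl → refl } }

seqʳ-embedding : IsEmbedding (seqʳ {Q = Q} {P = P})
seqʳ-embedding = record { monotone = λ _ _ h → ≤-seq ≤-refl h ; injective = λ { _ _ refl → refl } }

lowerBases-act : ∀ {a : Act} → LowerBasesOfMinimal (act a)
lowerBases-act _ (_ , ⊢⊥) _ = ⊥-lowerBasis
lowerBases-act _ (_ , ⊢⊤) _ = lowerComplementBasis (⊥ₚ ∷ []) ((λ ()) ∷ []) λ where
  (_ , ⊢⊥) → inj₂ (here ≤-refl)
  (_ , ⊢⊤) → inj₁ ≤-refl

lowerBasis-seqˡ : {x : Pos P} → LowerBasis x → LowerBasis (seqˡ {Q = Q} x)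
lowerBasis-seqˡ (lowerComplementBasis M M≱x split) =
  lowerComplementBasis (⊥ₚ ∷ map seqˡ M) ((λ ()) ∷ All.gmap⁺ (λ w≱x h → w≱x (proj₁ (⨾ᵖ-≤-inv h))) M≱x) λ where
    (_ , ⊢⊥) → inj₂ (here ⊥≤)
    (_ , ⊢⊤) → inj₁ ≤⊤
    (_ , ⊢seqˡ e) → Sum.map (λ h → ≤-seq h ≤-refl) (λ a → there (Any.gmap (λ h → ≤-seq h ≤-refl) a))
                            (split (_ , e))
    (_ , ⊢seqʳ _) → inj₁ (≤-seq ≤⊤ ⊥≤)

lowerBasis-seqʳ : {y : Pos Q} → ¬ y ≤ₚ ⊥ₚ → LowerBasis y → LowerBasis (seqʳ {P = P} y)
lowerBasis-seqʳ y≰⊥ (lowerComplementBasis M M≱y split) =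
  lowerComplementBasis (⊥ₚ ∷ map seqʳ M) ((λ ()) ∷ All.gmap⁺ (λ w≱y h → w≱y (proj₂ (⨾ᵖ-≤-inv h))) M≱y) λ where
    (_ , ⊢⊥) → inj₂ (here ⊥≤)
    (_ , ⊢⊤) → inj₁ ≤⊤
    (_ , ⊢seqˡ _) →
      [ (λ y≤⊥ → ⊥-elim (y≰⊥ y≤⊥)) , (λ a → inj₂ (there (Any.gmap (λ _ → ≤-seq ≤⊤ ⊥≤) a))) ]′ (split ⊥ₚ)
    (_ , ⊢seqʳ f) → Sum.map (≤-seq ≤-refl) (λ a → there (Any.gmap (≤-seq ≤-refl) a)) (split (_ , f))

⊤-lowerBasis-⨾ : LowerBasis (⊤ₚ {P = P ⨾ Q})
⊤-lowerBasis-⨾ = lowerComplementBasis (seqʳ ⊤ₚ ∷ []) ((λ ()) ∷ []) λ where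
  (_ , ⊢⊥) → inj₂ (here ⊥≤)
  (_ , ⊢⊤) → inj₁ ≤-refl
  (_ , ⊢seqˡ _) → inj₂ (here (≤-seq ≤⊤ ⊥≤))
  (_ , ⊢seqʳ _) → inj₂ (here (≤-seq ≤-refl ≤⊤))

minimal-seqˡ⇒lowerBasis : LowerBasesOfMinimal P → (x : Pos (P ⨾ Q)) (d : P ⊢ p) →
  MinimalOutside x (seqˡ (p , d)) → LowerBasis (p , d)
minimal-seqˡ⇒lowerBasis _ (_ , ⊢⊤) _ (minimalOutside y≰x _) = ⊥-elim (y≰x ≤⊤)
minimal-seqˡ⇒lowerBasis _ (_ , ⊢seqʳ _) _ (minimalOutside y≰x _) = ⊥-elim (y≰x (≤-seq ≤⊤ ⊥≤))
minimal-seqˡ⇒lowerBasis lP (_ , ⊢seqˡ d₀) d m@(minimalOutside y≰x _) = lP (_ , d₀) (_ , d)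
  (minimalOutside-reflect seqˡ-embedding (_ , d₀) (_ , d) (λ _ h → proj₁ (⨾ᵖ-≤-inv h))
                          (λ h → y≰x (≤-seq h ≤-refl)) m)
minimal-seqˡ⇒lowerBasis {p = p} lP (_ , ⊢⊥) d m with p ≟⊥
... | yes refl = ⊥-lowerBasis
... | no p≢⊥ = lP ⊥ₚ (_ , d) (minimalOutside-reflect seqˡ-embedding ⊥ₚ (_ , d) (λ _ ()) (p≢⊥ ∘ ≤⊥⇒≡⊥) m)

minimal-seqʳ⇒lowerBasis : LowerBasesOfMinimal Q → (x : Pos (P ⨾ Q)) (e : Q ⊢ q) → ¬ q ≡ ⊥ᵖ →
  MinimalOutside x (seqʳ (q , e)) → LowerBasis (q , e)
minimal-seqʳ⇒lowerBasis _ (_ , ⊢⊤) _ _ (minimalOutside y≰x _) = ⊥-elim (y≰x ≤⊤)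
minimal-seqʳ⇒lowerBasis _ (_ , ⊢⊥) _ _ (minimalOutside _ minimal)
  with minimal (seqˡ ⊥ₚ) (λ ()) (≤-seq ⊥≤ ⊥≤)
... | ()
minimal-seqʳ⇒lowerBasis lQ (_ , ⊢seqʳ e₀) e _ m@(minimalOutside y≰x _) = lQ (_ , e₀) (_ , e)
  (minimalOutside-reflect seqʳ-embedding (_ , e₀) (_ , e) (λ _ h → proj₂ (⨾ᵖ-≤-inv h))
                          (λ h → y≰x (≤-seq ≤-refl h)) m)
minimal-seqʳ⇒lowerBasis lQ (_ , ⊢seqˡ d₀) e q≢⊥ m@(minimalOutside _ minimal) with ⊤ₚ ≤ₚ? (_ , d₀)
... | yes _ = lQ ⊥ₚ (_ , e)
  (minimalOutside-reflect seqʳ-embedding ⊥ₚ (_ , e) (λ _ h → proj₂ (⨾ᵖ-≤-inv h)) (q≢⊥ ∘ ≤⊥⇒≡⊥) m)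
... | no ⊤≰p₀ with minimal (seqˡ ⊤ₚ) (λ h → ⊤≰p₀ (proj₁ (⨾ᵖ-≤-inv h))) (≤-seq ≤-refl ⊥≤)
...   | refl = ⊥-elim (q≢⊥ refl)

lowerBases-⨾ : LowerBasesOfMinimal P → LowerBasesOfMinimal Q → LowerBasesOfMinimal (P ⨾ Q)
lowerBases-⨾ _ _ _ (_ , ⊢⊥) _ = ⊥-lowerBasis
lowerBases-⨾ _ _ _ (_ , ⊢⊤) _ = ⊤-lowerBasis-⨾
lowerBases-⨾ lP _ x (_ , ⊢seqˡ d) m = lowerBasis-seqˡ (minimal-seqˡ⇒lowerBasis lP x d m)
lowerBases-⨾ lP lQ x (_ , ⊢seqʳ {q = q} e) m with q ≟⊥
... | yes refl =
  -- ⊤ ⨾ ⊥ is also seqˡ ⊤ₚ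
  lowerBasis-≈ refl (lowerBasis-seqˡ (minimal-seqˡ⇒lowerBasis lP x ⊢⊤ (minimalOutside-≈ refl m)))
... | no q≢⊥ = lowerBasis-seqʳ (q≢⊥ ∘ ≤⊥⇒≡⊥) (minimal-seqʳ⇒lowerBasis lQ x e q≢⊥ m)

altˡ-embedding : IsEmbedding (altˡ {P = P} {Q = Q})
altˡ-embedding = record { monotone = λ _ _ h → ≤-alt h ≤-refl ; injective = λ { _ _ refl → refl } }

altʳ-embedding : IsEmbedding (altʳ {Q = Q} {P = P})
altʳ-embedding = record { monotone = λ _ _ h → ≤-alt ≤-refl h ; injective = λ { _ _ refl → refl } }

⊥⊕⊥-lowerBasis : ∀ {d : P ⊢ ⊥ᵖ} → LowerBasis (altˡ {Q = Q} (⊥ᵖ , d))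
⊥⊕⊥-lowerBasis = lowerComplementBasis (⊥ₚ ∷ []) ((λ ()) ∷ []) λ where
  (_ , ⊢⊥) → inj₂ (here ≤-refl)
  (_ , ⊢⊤) → inj₁ ≤⊤
  (_ , ⊢altˡ _) → inj₁ (≤-alt ⊥≤ ≤-refl)
  (_ , ⊢altʳ _) → inj₁ (≤-alt ≤-refl ⊥≤)

⊤-lowerBasis-⊕ : LowerBasis (⊤ₚ {P = P ⊕ Q})
⊤-lowerBasis-⊕ = lowerComplementBasis (altˡ ⊤ₚ ∷ altʳ ⊤ₚ ∷ []) ((λ ()) ∷ (λ ()) ∷ []) λ where
  (_ , ⊢⊥) → inj₂ (here ⊥≤)
  (_ , ⊢⊤) → inj₁ ≤-refl
  (_ , ⊢altˡ _) → inj₂ (here (≤-alt ≤⊤ ≤-refl))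
  (_ , ⊢altʳ _) → inj₂ (there (here (≤-alt ≤-refl ≤⊤)))

lowerBasis-altˡ : {x : Pos P} → ¬ x ≤ₚ ⊥ₚ → LowerBasis x → LowerBasis (altˡ {Q = Q} x)
lowerBasis-altˡ x≰⊥ (lowerComplementBasis M M≱x split) =
  lowerComplementBasis (⊥ₚ ∷ altʳ ⊤ₚ ∷ map altˡ M)
    ((λ ()) ∷ (λ h → x≰⊥ (proj₁ (⊕ᵖ-≤-inv h))) ∷ All.gmap⁺ (λ w≱x h → w≱x (proj₁ (⊕ᵖ-≤-inv h))) M≱x) λ where
      (_ , ⊢⊥) → inj₂ (here ⊥≤)
      (_ , ⊢⊤) → inj₁ ≤⊤
      (_ , ⊢altˡ e) → Sum.map (λ h → ≤-alt h ≤-refl) (λ a → there (there (Any.gmap (λ h → ≤-alt h ≤-refl) a)))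
                              (split (_ , e))
      (_ , ⊢altʳ _) → inj₂ (there (here (≤-alt ≤-refl ≤⊤)))

lowerBasis-altʳ : {y : Pos Q} → ¬ y ≤ₚ ⊥ₚ → LowerBasis y → LowerBasis (altʳ {P = P} y)
lowerBasis-altʳ y≰⊥ (lowerComplementBasis M M≱y split) =
  lowerComplementBasis (⊥ₚ ∷ altˡ ⊤ₚ ∷ map altʳ M)
    ((λ ()) ∷ (λ h → y≰⊥ (proj₂ (⊕ᵖ-≤-inv h))) ∷ All.gmap⁺ (λ w≱y h → w≱y (proj₂ (⊕ᵖ-≤-inv h))) M≱y) λ where
      (_ , ⊢⊥) → inj₂ (here ⊥≤)
      (_ , ⊢⊤) → inj₁ ≤⊤
      (_ , ⊢altˡ _) → inj₂ (there (here (≤-alt ≤⊤ ≤-refl)))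
      (_ , ⊢altʳ f) → Sum.map (≤-alt ≤-refl) (λ a → there (there (Any.gmap (≤-alt ≤-refl) a))) (split (_ , f))

minimal-altˡ⇒lowerBasis : LowerBasesOfMinimal P → (x : Pos (P ⊕ Q)) (d : P ⊢ p) → ¬ p ≡ ⊥ᵖ →
  MinimalOutside x (altˡ (p , d)) → LowerBasis (p , d)
minimal-altˡ⇒lowerBasis _ (_ , ⊢⊤) _ _ (minimalOutside y≰x _) = ⊥-elim (y≰x ≤⊤)
minimal-altˡ⇒lowerBasis _ (_ , ⊢⊥) _ p≢⊥ (minimalOutside _ minimal)
  with minimal (altˡ ⊥ₚ) (λ ()) (≤-alt ⊥≤ ≤-refl)
... | refl = ⊥-elim (p≢⊥ refl)
minimal-altˡ⇒lowerBasis lP (_ , ⊢altˡ d₀) d _ m@(minimalOutside y≰x _) = lP (_ , d₀) (_ , d)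
  (minimalOutside-reflect altˡ-embedding (_ , d₀) (_ , d) (λ _ h → proj₁ (⊕ᵖ-≤-inv h))
                          (λ h → y≰x (≤-alt h ≤-refl)) m)
minimal-altˡ⇒lowerBasis lP (_ , ⊢altʳ _) d p≢⊥ m = lP ⊥ₚ (_ , d)
  (minimalOutside-reflect altˡ-embedding ⊥ₚ (_ , d) (λ _ h → proj₁ (⊕ᵖ-≤-inv h)) (p≢⊥ ∘ ≤⊥⇒≡⊥) m)

minimal-altʳ⇒lowerBasis : LowerBasesOfMinimal Q → (x : Pos (P ⊕ Q)) (e : Q ⊢ q) → ¬ q ≡ ⊥ᵖ →
  MinimalOutside x (altʳ (q , e)) → LowerBasis (q , e)
minimal-altʳ⇒lowerBasis _ (_ , ⊢⊤) _ _ (minimalOutside y≰x _) = ⊥-elim (y≰x ≤⊤)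
minimal-altʳ⇒lowerBasis _ (_ , ⊢⊥) _ q≢⊥ (minimalOutside _ minimal)
  with minimal (altʳ ⊥ₚ) (λ ()) (≤-alt ≤-refl ⊥≤)
... | refl = ⊥-elim (q≢⊥ refl)
minimal-altʳ⇒lowerBasis lQ (_ , ⊢altʳ e₀) e _ m@(minimalOutside y≰x _) = lQ (_ , e₀) (_ , e)
  (minimalOutside-reflect altʳ-embedding (_ , e₀) (_ , e) (λ _ h → proj₂ (⊕ᵖ-≤-inv h))
                          (λ h → y≰x (≤-alt ≤-refl h)) m)
minimal-altʳ⇒lowerBasis lQ (_ , ⊢altˡ _) e q≢⊥ m = lQ ⊥ₚ (_ , e)
  (minimalOutside-reflect altʳ-embedding ⊥ₚ (_ , e) (λ _ h → proj₂ (⊕ᵖ-≤-inv h)) (q≢⊥ ∘ ≤⊥⇒≡⊥) m)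

lowerBases-⊕ : LowerBasesOfMinimal P → LowerBasesOfMinimal Q → LowerBasesOfMinimal (P ⊕ Q)
lowerBases-⊕ _ _ _ (_ , ⊢⊥) _ = ⊥-lowerBasis
lowerBases-⊕ _ _ _ (_ , ⊢⊤) _ = ⊤-lowerBasis-⊕
lowerBases-⊕ lP _ x (_ , ⊢altˡ {p = p} d) m with p ≟⊥
... | yes refl = ⊥⊕⊥-lowerBasis
... | no p≢⊥ = lowerBasis-altˡ (p≢⊥ ∘ ≤⊥⇒≡⊥) (minimal-altˡ⇒lowerBasis lP x d p≢⊥ m)
lowerBases-⊕ _ lQ x (_ , ⊢altʳ {q = q} e) m with q ≟⊥
... | yes refl = lowerBasis-≈ refl (⊥⊕⊥-lowerBasis {d = ⊢⊥})
... | no q≢⊥ = lowerBasis-altʳ (q≢⊥ ∘ ≤⊥⇒≡⊥) (minimal-altʳ⇒lowerBasis lQ x e q≢⊥ m)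

parˡ-embedding : IsEmbedding (λ (x : Pos P) → par {Q = Q} x ⊥ₚ)
parˡ-embedding = record { monotone = λ _ _ h → ≤-par h ≤-refl ; injective = λ { _ _ refl → refl } }

parʳ-embedding : IsEmbedding (par {P = P} {Q = Q} ⊥ₚ)
parʳ-embedding = record { monotone = λ _ _ h → ≤-par ≤-refl h ; injective = λ { _ _ refl → refl } }

⊤-lowerBasis-∥ : LowerBasis (⊤ₚ {P = P ∥ Q})
⊤-lowerBasis-∥ = lowerComplementBasis (par ⊤ₚ ⊤ₚ ∷ []) ((λ ()) ∷ []) λ where
  (_ , ⊢⊥) → inj₂ (here ⊥≤)
  (_ , ⊢⊤) → inj₁ ≤-refl
  (_ , ⊢par _ _) → inj₂ (here (≤-par ≤⊤ ≤⊤))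

lowerBasis-par : {x : Pos P} {y : Pos Q} → LowerBasis x → LowerBasis y → LowerBasis (par x y)
lowerBasis-par (lowerComplementBasis M M≱x splitP) (lowerComplementBasis N N≱y splitQ) =
  lowerComplementBasis (⊥ₚ ∷ map (λ w → par w ⊤ₚ) M ++ map (par ⊤ₚ) N)
    ((λ ()) ∷ All.++⁺ (All.gmap⁺ (λ w≱x h → w≱x (proj₁ (∥ᵖ-≤-inv h))) M≱x)
                      (All.gmap⁺ (λ w≱y h → w≱y (proj₂ (∥ᵖ-≤-inv h))) N≱y)) λ where
      (_ , ⊢⊥) → inj₂ (here ⊥≤)
      (_ , ⊢⊤) → inj₁ ≤⊤
      (_ , ⊢par f g) →
        [ (λ x≤f → Sum.map (≤-par x≤f)
                     (λ a → there (Any.++⁺ʳ (map (λ w → par w ⊤ₚ) M) (Any.gmap (≤-par ≤⊤) a)))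
                     (splitQ (_ , g)))
        , (λ a → inj₂ (there (Any.++⁺ˡ (Any.gmap (λ h → ≤-par h ≤⊤) a)))) ]′ (splitP (_ , f))

-- One component of a minimal y is ⊥: the other one alone already lies outside ↓x.
lowerBases-∥ : LowerBasesOfMinimal P → LowerBasesOfMinimal Q → LowerBasesOfMinimal (P ∥ Q)
lowerBases-∥ _ _ _ (_ , ⊢⊥) _ = ⊥-lowerBasis
lowerBases-∥ _ _ _ (_ , ⊢⊤) _ = ⊤-lowerBasis-∥
lowerBases-∥ _ _ (_ , ⊢⊤) (_ , ⊢par _ _) (minimalOutside y≰x _) = ⊥-elim (y≰x ≤⊤)
lowerBases-∥ _ _ (_ , ⊢⊥) (_ , ⊢par _ _) (minimalOutside _ minimal)
  with minimal (par ⊥ₚ ⊥ₚ) (λ ()) (≤-par ⊥≤ ⊥≤)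
... | refl = lowerBasis-par ⊥-lowerBasis ⊥-lowerBasis
lowerBases-∥ lP lQ (_ , ⊢par d₀ e₀) (_ , ⊢par d e) m@(minimalOutside y≰x minimal) with (_ , d) ≤ₚ? (_ , d₀)
... | no p≰p₀ with minimal (par (_ , d) ⊥ₚ) (λ h → p≰p₀ (proj₁ (∥ᵖ-≤-inv h))) (≤-par ≤-refl ⊥≤)
...   | refl = lowerBasis-par (lP (_ , d₀) (_ , d)
  (minimalOutside-reflect parˡ-embedding (_ , d₀) (_ , d) (λ _ h → proj₁ (∥ᵖ-≤-inv h)) p≰p₀
                          (minimalOutside-≈ refl m))) ⊥-lowerBasis
lowerBases-∥ lP lQ (_ , ⊢par d₀ e₀) (_ , ⊢par d e) m@(minimalOutside y≰x minimal) | yes p≤p₀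
  with minimal (par ⊥ₚ (_ , e)) (λ h → y≰x (≤-par p≤p₀ (proj₂ (∥ᵖ-≤-inv h)))) (≤-par ⊥≤ ≤-refl)
... | refl = lowerBasis-par ⊥-lowerBasis (lQ (_ , e₀) (_ , e)
  (minimalOutside-reflect parʳ-embedding (_ , e₀) (_ , e) (λ _ h → proj₂ (∥ᵖ-≤-inv h))
                          (λ h → y≰x (≤-par p≤p₀ h)) (minimalOutside-≈ refl m)))

star-embedding : ∀ n → IsEmbedding (star {P = P} n)
star-embedding _ = record { monotone = λ _ _ → ≤-star ; injective = λ { _ _ refl → refl } }

belowExponent : ℕ → List (Pos (P ⋆))
belowExponent zero = []
belowExponent (suc n) = star n ⊤ₚ ∷ []

belowExponent-≱ : ∀ n → All (λ w → ¬ ((p ^ᵖ n) ≤ᵖ proj₁ w)) (belowExponent {P = P} n)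
belowExponent-≱ zero = []
belowExponent-≱ (suc n) = (λ h → ℕₚ.1+n≰n (^ᵖ-≤-exponent h)) ∷ []

belowExponent-covers : ∀ {r k} n → k < n → Any (λ w → (r ^ᵖ k) ≤ᵖ proj₁ w) (belowExponent {P = P} n)
belowExponent-covers (suc n) (s≤s k≤n) = here (^ᵖ-mono k≤n ≤⊤)

lowerBasis-star : ∀ n {x : Pos P} → LowerBasis x → LowerBasis (star n x)
lowerBasis-star {P = P} n {p , _} (lowerComplementBasis M M≱x split) =
  lowerComplementBasis (⊥ₚ ∷ map (star n) M ++ belowExponent n)
    ((λ ()) ∷ All.++⁺ (All.gmap⁺ (λ w≱x h → w≱x (^ᵖ-≤-base h)) M≱x) (belowExponent-≱ n)) λ where
      (_ , ⊢⊥) → inj₂ (here ⊥≤)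
      (_ , ⊢⊤) → inj₁ ≤⊤
      (_ , ⊢star k e) → split-star e (ℕₚ.<-cmp k n)
  where
  split-star : ∀ {r k} (e : P ⊢ r) → Tri (k < n) (k ≡ n) (n < k) →
    (p ^ᵖ n) ≤ᵖ (r ^ᵖ k) ⊎ Any (λ w → (r ^ᵖ k) ≤ᵖ proj₁ w) (⊥ₚ ∷ map (star n) M ++ belowExponent n)
  split-star e (tri< k<n _ _) = inj₂ (there (Any.++⁺ʳ (map (star n) M) (belowExponent-covers n k<n)))
  split-star e (tri≈ _ refl _) = Sum.map ≤-star (λ a → there (Any.++⁺ˡ (Any.gmap ≤-star a))) (split (_ , e))
  split-star e (tri> _ _ n<k) = inj₁ (≤-iter n<k)

lowerBases-⋆ : LowerBasesOfMinimal P → LowerBasesOfMinimal (P ⋆)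
lowerBases-⋆ _ _ (_ , ⊢⊥) _ = ⊥-lowerBasis
lowerBases-⋆ _ (_ , ⊢⊥) (_ , ⊢⊤) (minimalOutside _ minimal) with minimal (star 0 ⊥ₚ) (λ ()) ≤⊤
... | ()
lowerBases-⋆ _ (_ , ⊢⊤) (_ , ⊢⊤) (minimalOutside y≰x _) = ⊥-elim (y≰x ≤-refl)
lowerBases-⋆ _ (_ , ⊢star k _) (_ , ⊢⊤) (minimalOutside _ minimal)
  with minimal (star (suc k) ⊥ₚ) (λ h → ℕₚ.1+n≰n (^ᵖ-≤-exponent h)) ≤⊤
... | ()
lowerBases-⋆ _ (_ , ⊢⊤) (_ , ⊢star _ _) (minimalOutside y≰x _) = ⊥-elim (y≰x ≤⊤)
lowerBases-⋆ _ (_ , ⊢⊥) (_ , ⊢star _ _) (minimalOutside _ minimal)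
  with minimal (star 0 ⊥ₚ) (λ ()) (^ᵖ-mono z≤n ⊥≤)
... | refl = lowerBasis-star 0 ⊥-lowerBasis
lowerBases-⋆ lP (_ , ⊢star k d₀) (_ , ⊢star n d) m@(minimalOutside y≰x minimal) with ℕₚ.<-cmp n k
... | tri< n<k _ _ = ⊥-elim (y≰x (≤-iter n<k))
... | tri≈ _ refl _ = lowerBasis-star n (lP (_ , d₀) (_ , d)
  (minimalOutside-reflect (star-embedding n) (_ , d₀) (_ , d) (λ _ → ^ᵖ-≤-base) (λ h → y≰x (≤-star h)) m))
... | tri> _ _ k<n with minimal (star (suc k) ⊥ₚ) (λ h → ℕₚ.1+n≰n (^ᵖ-≤-exponent h)) (^ᵖ-mono k<n ⊥≤)
...   | refl = lowerBasis-star (suc k) ⊥-lowerBasis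

lowerBasesOfMinimal : (P : Prog Act) → LowerBasesOfMinimal P
lowerBasesOfMinimal (act a) = lowerBases-act
lowerBasesOfMinimal (P ⨾ Q) = lowerBases-⨾ (lowerBasesOfMinimal P) (lowerBasesOfMinimal Q)
lowerBasesOfMinimal (P ⋆) = lowerBases-⋆ (lowerBasesOfMinimal P)
lowerBasesOfMinimal (P ⊕ Q) = lowerBases-⊕ (lowerBasesOfMinimal P) (lowerBasesOfMinimal Q)
lowerBasesOfMinimal (P ∥ Q) = lowerBases-∥ (lowerBasesOfMinimal P) (lowerBasesOfMinimal Q)

isFinitelyComplemented : (P : Prog Act) → OrderNotions.FinitelyComplemented (_≈Pos_ P) (_≤Pos_ P)
isFinitelyComplemented P =
  (λ _ _ y _ → upperComplementBasis⇒finitelyUpperComplemented ≤ᵖ-trans {_≈_ = _≈Pos_ P} (upperBases P y)) ,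
  (λ x _ y (y≰x , minimal) →
     lowerComplementBasis⇒finitelyLowerComplemented {_≈_ = _≈Pos_ P} ≤ᵖ-trans
       (lowerBasesOfMinimal P x y (minimalOutside y≰x minimal)))

proposition7p2 : {Act : Set} (P : Prog Act) →
    OrderNotions.IsLatticeOrder (_≈Pos_ P) (_≤Pos_ P)
    × OrderNotions.IsWellOrder (_≈Pos_ P) (_≤Pos_ P)
    × OrderNotions.FinitelyComplemented (_≈Pos_ P) (_≤Pos_ P)
proposition7p2 P = isLatticeOrder P , isWellOrder P , isFinitelyComplemented P
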